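{- Let $G$ be a connected non-bipartite graph and let $p$ be an odd prime. If there is an index function $\eta$ of $G$ with $\eta(e)=0$ for every edge $e$ and $\sum_{v\in V(G)}\eta(v)=|E(G)|$ (so that $A=A_G(\eta)$ is a square matrix all of whose columns are vertex columns of $A_G$) such that $\mathrm{per}(A)\not\equiv 0 \pmod p$, then $G$ has a permanent-non-singular $(0,p-1)$-matrix.
   Context: Graphs are finite and simple. For a graph $G$, fix an orientation $D$ of $G$. Let $A_G$ be the matrix whose rows are indexed by $E(G)$ and whose columns are indexed by $V(G)\cup E(G)$. For an edge $e$ oriented from $u$ to $v$ and $z\in V(G)\cup E(G)$: $A_G[e,z]=1$ if $z=v$ or $z\neq e$ is an edge incident to $v$; $A_G[e,z]=-1$ if $z=u$ or $z\neq e$ is an edge incident to $u$; and $A_G[e,z]=0$ otherwise. Columns indexed by vertices are called vertex columns, those indexed by edges edge columns. An index function is a map $\eta:V(G)\cup E(G)\to\{0,1,2,\dots\}$; $A_G(\eta)$ denotes the matrix whose columns are columns of $A_G$, with each column indexed by $z$ occurring exactly $\eta(z)$ times. An $(a,b)$-matrix of $G$ is a square matrix $A_G(\eta)$ with $\eta(v)\le a$ for every vertex $v$ and $\eta(e)\le b$ for every edge $e$. A square matrix is permanent-non-singular if its permanent is nonzero. (Reversing the orientation of an edge negates one row of $A_G$, so these notions do not depend on the chosen orientation.) -}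

module Defs where

open import Data.Nat using (ℕ; zero; suc)
open import Data.Bool using (Bool; true; false; if_then_else_; _∨_)
open import Data.Fin using (Fin; cast)
open import Data.Fin.Properties using () renaming (_≟_ to _≟ᶠ_)
open import Data.Integer using (ℤ; 0ℤ; 1ℤ; -1ℤ; _+_; _*_)
open import Data.List using (List; []; _∷_; [_]; map; concatMap; replicate; allFin; _++_; length; lookup; foldr; filter)
open import Data.Vec using (Vec; toList) renaming (lookup to vlookup; [] to v[]; _∷_ to _v∷_)
open import Data.Sum using (_⊎_; inj₁; inj₂)
open import Data.Product using (Σ; ∃; _×_; _,_)
open import Data.Empty using (⊥)
open import Relation.Nullary using (¬_)
open import Relation.Nullary.Decidable using (⌊_⌋)
open import Relation.Binary.PropositionalEquality using (_≡_; _≢_; sym)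
open import Relation.Binary.Construct.Closure.ReflexiveTransitive using (Star)
import Data.List.Relation.Unary.Unique.DecPropositional as UniqueDec

-- A finite simple graph on vertex set Fin n with edge set Fin m.
-- Edge e joins tl e and hd e; this also fixes the orientation D (tl e → hd e).
record Graph : Set where
  field
    n m      : ℕ
    tl hd    : Fin m → Fin n
    loopless : ∀ e → tl e ≢ hd e
    simple   : ∀ e f → ((tl e ≡ tl f × hd e ≡ hd f) ⊎ (tl e ≡ hd f × hd e ≡ tl f)) → e ≡ f

module _ (G : Graph) where
  open Graph G

  Adj : Fin n → Fin n → Set
  Adj u v = ∃ λ e → (tl e ≡ u × hd e ≡ v) ⊎ (tl e ≡ v × hd e ≡ u)

  Connected : Set
  Connected = ∀ u v → Star Adj u v

  Bipartite : Set
  Bipartite = Σ (Fin n → Bool) λ c → ∀ e → c (tl e) ≢ c (hd e)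

  Idx : Set
  Idx = Fin n ⊎ Fin m

  incident : Fin m → Fin n → Bool
  incident f w = ⌊ tl f ≟ᶠ w ⌋ ∨ ⌊ hd f ≟ᶠ w ⌋

  A : Fin m → Idx → ℤ
  A e (inj₁ w) = if ⌊ w ≟ᶠ hd e ⌋ then 1ℤ else (if ⌊ w ≟ᶠ tl e ⌋ then -1ℤ else 0ℤ)
  A e (inj₂ f) = if ⌊ f ≟ᶠ e ⌋ then 0ℤ
                 else (if incident f (hd e) then 1ℤ
                 else (if incident f (tl e) then -1ℤ else 0ℤ))

  IndexFunction : Set
  IndexFunction = Idx → ℕ

  allIdx : List Idx
  allIdx = map inj₁ (allFin n) ++ map inj₂ (allFin m)

  columns : IndexFunction → List Idx
  columns η = concatMap (λ z → replicate (η z) z) allIdx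

  Square : IndexFunction → Set
  Square η = length (columns η) ≡ m

  AG : (η : IndexFunction) → Square η → Fin m → Fin m → ℤ
  AG η sq e j = A e (lookup (columns η) (cast (sym sq) j))

allVecs : (k l : ℕ) → List (Vec (Fin k) l)
allVecs k zero = [ v[] ]
allVecs k (suc l) = concatMap (λ i → map (i v∷_) (allVecs k l)) (allFin k)

permutations : (k : ℕ) → List (Vec (Fin k) k)
permutations k = filter (λ σ → UniqueDec.unique? _≟ᶠ_ (toList σ)) (allVecs k k)

sumℤ : List ℤ → ℤ
sumℤ = foldr _+_ 0ℤ

prodℤ : List ℤ → ℤ
prodℤ = foldr _*_ 1ℤ

per : {k : ℕ} → (Fin k → Fin k → ℤ) → ℤ
per {k} M = sumℤ (map (λ σ → prodℤ (map (λ i → M i (vlookup σ i)) (allFin k))) (permutations k))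

PermanentNonSingular : {k : ℕ} → (Fin k → Fin k → ℤ) → Set
PermanentNonSingular M = per M ≢ 0ℤ

HasPNS-ab-Matrix : (G : Graph) → ℕ → ℕ → Set
HasPNS-ab-Matrix G a b =
  Σ (IndexFunction G) λ η →
    (∀ v → η (inj₁ v) Data.Nat.≤ a) ×
    (∀ e → η (inj₂ e) Data.Nat.≤ b) ×
    Σ (Square G η) λ sq → PermanentNonSingular (AG G η sq)

-- Each edge column of A_G is the sum of the vertex columns of its two ends.  Along a walk
-- of length ℓ from u to v, the column of u minus (-1)^ℓ times the column of v is therefore
-- an integer combination of edge columns, and an odd closed walk through v, which exists
-- because G is connected and not bipartite, shows that twice the column of v is one.  The
-- permanent is linear in each column, so doubling a vertex column of A and expanding writes
-- 2·per A as an integer combination of permanents in which that column has become an edge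
-- column; since p is odd, one of them is still not divisible by p.  Replacing the vertex
-- columns one at a time gives a matrix of edge columns whose permanent is not divisible by
-- p.  Finally, a column occurring t times makes t! divide the permanent, so no edge column
-- occurs p times or more.

module Submission where

open import Defs
open import Data.Nat using (ℕ; _∸_)
open import Data.Nat.Primality using (Prime)
open import Data.Integer using (+_)
open import Data.Integer.Divisibility using (_∣_)
open import Data.Sum using (inj₁; inj₂)
open import Data.Product using (Σ; _×_)
open import Relation.Nullary using (¬_)
open import Relation.Binary.PropositionalEquality using (_≡_; _≢_)

import Data.Integer.Properties as ℤP
import Data.Nat.Properties as ℕP
open import Algebra.Properties.CommutativeMonoid.Sum ℤP.+-0-commutativeMonoid
  using (sum; sum-cong-≗; sum-remove; sum-replicate-zero; ∑-permute; ∑-distrib-+)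
open import Algebra.Properties.CommutativeMonoid.Sum ℕP.+-0-commutativeMonoid
  using () renaming (sum to ∑ℕ; sum-remove to ∑ℕ-remove; sum-replicate-zero to ∑ℕ-replicate-zero)
open import Algebra.Properties.Semiring.Sum ℤP.+-*-semiring using (*-distribˡ-sum)
open import Data.Bool using (Bool; true; false; if_then_else_; _∧_; not)
open import Data.Bool.Properties using (¬-not) renaming (_≟_ to _≟ᵇ_)
open import Data.Fin as Fin using (Fin; zero; suc; punchIn; punchOut)
open import Data.Fin.Permutation
  using (Permutation′; _⟨$⟩ʳ_; _∘ₚ_; cast-id; remove; punchIn-permute; transpose)
open import Data.Fin.Properties
  using (punchIn-injective; punchInᵢ≢i; punchIn-punchOut; cast-involutive; any?; ¬∀⟶∃¬)
  renaming (_≟_ to _≟ᶠ_)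
open import Data.Integer as ℤ using (ℤ; 0ℤ; 1ℤ; -1ℤ; _+_; _*_; _-_)
open import Data.Integer.Divisibility.Signed
  using (divides; _∣?_; ∣-trans; ∣⇒∣ᵤ; ∣ᵤ⇒∣; ∣m∣n⇒∣m+n; ∣n⇒∣m*n; *-monoʳ-∣)
  renaming (_∣_ to _∣ₛ_)
open import Data.Integer.Tactic.RingSolver using (solve-∀)
open import Data.List
  using (List; []; _∷_; _++_; map; concatMap; replicate; allFin; filter; tabulate; length; lookup)
open import Data.List.Properties
  using (map-++; map-∘; map-cong; map-tabulate; tabulate-cong; length-tabulate; lookup-tabulate)
open import Data.List.Membership.Propositional using (_∈_)
open import Data.List.Membership.Propositional.Properties using (∈-allFin; ∈-map⁻; ∈-map⁺; ∈-++⁺ˡ; ∈-++⁺ʳ)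
open import Data.List.Relation.Binary.Permutation.Homogeneous using (onIndices)
open import Data.List.Relation.Binary.Permutation.Propositional
  using (_↭_; ↭⇒↭ₛ; prep; ↭-trans; ↭-reflexive; module PermutationReasoning)
open import Data.List.Relation.Binary.Permutation.Propositional.Properties using (++⁺ˡ; shift; ↭-length)
import Data.List.Relation.Binary.Permutation.Setoid.Properties as ↭ₛ
open import Data.List.Relation.Unary.All as All using (All; []; _∷_; all?)
open import Data.List.Relation.Unary.AllPairs using ([]; _∷_)
open import Data.List.Relation.Unary.Any using (here; there)
open import Data.List.Relation.Unary.Unique.Propositional using (Unique)
import Data.List.Relation.Unary.Unique.Propositional.Properties as Unique
import Data.List.Relation.Unary.Unique.DecPropositional as UniqueDec
open import Data.Nat as ℕ using (zero; suc; _!; nonTrivial⇒n>1)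
open import Data.Nat.Divisibility using (m∣m*n; m≤n⇒m!∣n!)
  renaming (_∣_ to _ℕ∣_; ∣⇒≤ to ℕ∣⇒≤; ∣-trans to ℕ∣-trans)
open import Data.Nat.Primality using (euclidsLemma; prime⇒nonTrivial)
open import Data.Product using (∃; _,_; map₁; proj₁; proj₂)
open import Data.Sum.Properties using (≡-dec; inj₁-injective; inj₂-injective)
open import Data.Vec using (Vec; toList)
  renaming ([] to []ᵛ; _∷_ to _∷ᵛ_; map to mapᵛ; lookup to lookupᵛ)
open import Data.Vec.Properties using (lookup-map)
open import Data.Vec.Functional using (updateAt)
open import Data.Vec.Functional.Properties
  using (updateAt-updates; updateAt-minimal; updateAt-cong-local; updateAt-id-local; map-updateAt-local)
open import Function using (_∘_; id; const)
open import Relation.Binary.Construct.Closure.ReflexiveTransitive using (Star; ε; _◅_)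
open import Relation.Binary.Definitions using (DecidableEquality)
open import Relation.Binary.PropositionalEquality
  using (refl; sym; trans; cong; cong₂; subst; setoid; ≢-sym; module ≡-Reasoning)
open import Relation.Nullary using (Dec; does; yes; no; contradiction)
open import Relation.Nullary.Decidable using (dec-true; dec-false; ¬?; decidable-stable)

sumℤ-++ : ∀ (xs ys : List ℤ) → sumℤ (xs ++ ys) ≡ sumℤ xs + sumℤ ys
sumℤ-++ []       ys = sym (ℤP.+-identityˡ _)
sumℤ-++ (x ∷ xs) ys = trans (cong (_+_ x) (sumℤ-++ xs ys)) (sym (ℤP.+-assoc x _ _))

sumℤ-map-concatMap : ∀ {A B : Set} (F : B → ℤ) (h : A → List B) (xs : List A) →
  sumℤ (map F (concatMap h xs)) ≡ sumℤ (map (λ x → sumℤ (map F (h x))) xs)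
sumℤ-map-concatMap F h []       = refl
sumℤ-map-concatMap F h (x ∷ xs) = begin
  sumℤ (map F (h x ++ concatMap h xs))               ≡⟨ cong sumℤ (map-++ F (h x) _) ⟩
  sumℤ (map F (h x) ++ map F (concatMap h xs))       ≡⟨ sumℤ-++ (map F (h x)) _ ⟩
  sumℤ (map F (h x)) + sumℤ (map F (concatMap h xs)) ≡⟨ cong (_+_ (sumℤ (map F (h x)))) (sumℤ-map-concatMap F h xs) ⟩
  sumℤ (map F (h x)) + sumℤ (map (λ y → sumℤ (map F (h y))) xs) ∎
  where open ≡-Reasoning

sumℤ-map-filter : ∀ {A : Set} {P : A → Set} (P? : ∀ x → Dec (P x)) (F : A → ℤ) (xs : List A) →
  sumℤ (map F (filter P? xs)) ≡ sumℤ (map (λ x → if does (P? x) then F x else 0ℤ) xs)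
sumℤ-map-filter P? F []       = refl
sumℤ-map-filter P? F (x ∷ xs) with does (P? x)
... | true  = cong (_+_ (F x)) (sumℤ-map-filter P? F xs)
... | false = trans (sumℤ-map-filter P? F xs) (sym (ℤP.+-identityˡ _))

sumℤ-map-tabulate : ∀ {A : Set} {k} (F : A → ℤ) (g : Fin k → A) → sumℤ (map F (tabulate g)) ≡ sum (F ∘ g)
sumℤ-map-tabulate {k = zero}  F g = refl
sumℤ-map-tabulate {k = suc k} F g = cong (_+_ (F (g zero))) (sumℤ-map-tabulate F (g ∘ suc))

sumTuples : ∀ k l → (Vec (Fin k) l → ℤ) → ℤ
sumTuples k zero    F = F []ᵛ
sumTuples k (suc l) F = sum λ i → sumTuples k l (F ∘ (i ∷ᵛ_))

sumℤ-allVecs : ∀ k l (F : Vec (Fin k) l → ℤ) → sumℤ (map F (allVecs k l)) ≡ sumTuples k l F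
sumℤ-allVecs k zero    F = ℤP.+-identityʳ _
sumℤ-allVecs k (suc l) F = begin
  sumℤ (map F (concatMap (λ i → map (i ∷ᵛ_) (allVecs k l)) (allFin k)))
    ≡⟨ sumℤ-map-concatMap F _ (allFin k) ⟩
  sumℤ (map (λ i → sumℤ (map F (map (i ∷ᵛ_) (allVecs k l)))) (allFin k))
    ≡⟨ cong sumℤ (map-cong (λ i → cong sumℤ (sym (map-∘ (allVecs k l)))) (allFin k)) ⟩
  sumℤ (map (λ i → sumℤ (map (F ∘ (i ∷ᵛ_)) (allVecs k l))) (allFin k))
    ≡⟨ cong sumℤ (map-cong (λ i → sumℤ-allVecs k l (F ∘ (i ∷ᵛ_))) (allFin k)) ⟩
  sumℤ (map (λ i → sumTuples k l (F ∘ (i ∷ᵛ_))) (allFin k))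
    ≡⟨ sumℤ-map-tabulate (λ i → sumTuples k l (F ∘ (i ∷ᵛ_))) id ⟩
  sumTuples k (suc l) F ∎
  where open ≡-Reasoning

sumTuples-cong : ∀ k l {F G : Vec (Fin k) l → ℤ} → (∀ w → F w ≡ G w) → sumTuples k l F ≡ sumTuples k l G
sumTuples-cong k zero    eq = eq []ᵛ
sumTuples-cong k (suc l) eq = sum-cong-≗ {k} λ i → sumTuples-cong k l (eq ∘ (i ∷ᵛ_))

sumTuples-zero : ∀ k l → sumTuples k l (λ _ → 0ℤ) ≡ 0ℤ
sumTuples-zero k zero    = refl
sumTuples-zero k (suc l) = trans (sum-cong-≗ {k} λ _ → sumTuples-zero k l) (sum-replicate-zero k)

sumTuples-scale : ∀ k l a (F : Vec (Fin k) l → ℤ) → sumTuples k l (λ w → a * F w) ≡ a * sumTuples k l F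
sumTuples-scale k zero    a F = refl
sumTuples-scale k (suc l) a F =
  trans (sum-cong-≗ {k} λ i → sumTuples-scale k l a (F ∘ (i ∷ᵛ_)))
        (sym (*-distribˡ-sum a λ i → sumTuples k l (F ∘ (i ∷ᵛ_))))

-- Laplace expansion of the permanent

freshIn : ∀ {k l} → Fin k → Vec (Fin k) l → Bool
freshIn x []ᵛ      = true
freshIn x (y ∷ᵛ w) = not (does (x ≟ᶠ y)) ∧ freshIn x w

distinct : ∀ {k l} → Vec (Fin k) l → Bool
distinct []ᵛ      = true
distinct (x ∷ᵛ w) = freshIn x w ∧ distinct w

unique?≡distinct : ∀ {k l} (w : Vec (Fin k) l) → does (UniqueDec.unique? _≟ᶠ_ (toList w)) ≡ distinct w
unique?≡distinct []ᵛ      = refl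
unique?≡distinct (x ∷ᵛ w) = cong₂ _∧_ (all?≡freshIn w) (unique?≡distinct w)
  where
  all?≡freshIn : ∀ {l} (v : Vec _ l) → does (all? (λ y → ¬? (x ≟ᶠ y)) (toList v)) ≡ freshIn x v
  all?≡freshIn []ᵛ      = refl
  all?≡freshIn (y ∷ᵛ v) = cong (not (does (x ≟ᶠ y)) ∧_) (all?≡freshIn v)

does-≟-injective : ∀ {k l} {π : Fin k → Fin l} → (∀ {a b} → π a ≡ π b → a ≡ b) →
  ∀ x y → does (π x ≟ᶠ π y) ≡ does (x ≟ᶠ y)
does-≟-injective {π = π} inj x y with π x ≟ᶠ π y | x ≟ᶠ y
... | yes _  | yes _    = refl
... | no  _  | no  _    = refl
... | yes e  | no x≢y   = contradiction (inj e) x≢y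
... | no ne  | yes refl = contradiction refl ne

distinct-map : ∀ {k k′ l} {π : Fin k → Fin k′} → (∀ {a b} → π a ≡ π b → a ≡ b) →
  (w : Vec (Fin k) l) → distinct (mapᵛ π w) ≡ distinct w
distinct-map {π = π} inj []ᵛ      = refl
distinct-map {π = π} inj (x ∷ᵛ w) = cong₂ _∧_ (freshIn-map w) (distinct-map inj w)
  where
  freshIn-map : ∀ {l} (v : Vec _ l) → freshIn (π x) (mapᵛ π v) ≡ freshIn x v
  freshIn-map []ᵛ      = refl
  freshIn-map (y ∷ᵛ v) = cong₂ (λ b c → not b ∧ c) (does-≟-injective inj x y) (freshIn-map v)

Matrix : ℕ → Set
Matrix k = Fin k → Fin k → ℤ

diagonalProduct : ∀ {k l} → (Fin l → Fin k → ℤ) → Vec (Fin k) l → ℤ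
diagonalProduct M σ = prodℤ (tabulate λ i → M i (lookupᵛ σ i))

permanentTerm : ∀ {k l} → (Fin l → Fin k → ℤ) → Vec (Fin k) l → ℤ
permanentTerm M σ = if distinct σ then diagonalProduct M σ else 0ℤ

per≡sumTuples : ∀ {k} (M : Matrix k) → per M ≡ sumTuples k k (permanentTerm M)
per≡sumTuples {k} M = begin
  per M
    ≡⟨ sumℤ-map-filter unique? product (allVecs k k) ⟩
  sumℤ (map (λ σ → if does (unique? σ) then product σ else 0ℤ) (allVecs k k))
    ≡⟨ cong sumℤ (map-cong termwise (allVecs k k)) ⟩
  sumℤ (map (permanentTerm M) (allVecs k k))
    ≡⟨ sumℤ-allVecs k k (permanentTerm M) ⟩
  sumTuples k k (permanentTerm M) ∎
  where
  open ≡-Reasoning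
  unique? : (σ : Vec (Fin k) k) → Dec _
  unique? σ = UniqueDec.unique? _≟ᶠ_ (toList σ)
  product : Vec (Fin k) k → ℤ
  product σ = prodℤ (map (λ i → M i (lookupᵛ σ i)) (allFin k))
  termwise : ∀ σ → (if does (unique? σ) then product σ else 0ℤ) ≡ permanentTerm M σ
  termwise σ = cong₂ (if_then_else 0ℤ) (unique?≡distinct σ) (cong prodℤ (map-tabulate id (λ i → M i (lookupᵛ σ i))))

per-cong : ∀ {k} {M N : Matrix k} → (∀ i c → M i c ≡ N i c) → per M ≡ per N
per-cong {k} eq =
  cong sumℤ (map-cong (λ σ → cong prodℤ (map-cong (λ i → eq i (lookupᵛ σ i)) (allFin k))) (permutations k))

minor : ∀ {k} → Fin (suc k) → Matrix (suc k) → Matrix k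
minor j M i c = M (suc i) (punchIn j c)

sumTuples-avoiding : ∀ k l (j : Fin (suc k)) (G : Vec (Fin (suc k)) l → ℤ) →
  sumTuples (suc k) l (λ w → if freshIn j w then G w else 0ℤ) ≡ sumTuples k l (G ∘ mapᵛ (punchIn j))
sumTuples-avoiding k zero    j G = refl
sumTuples-avoiding k (suc l) j G = begin
  sum T                                             ≡⟨ sum-remove {i = j} T ⟩
  T j + sum (T ∘ punchIn j)                         ≡⟨ cong₂ _+_ T-j (sum-cong-≗ {k} T-punchIn) ⟩
  0ℤ + sumTuples k (suc l) (G ∘ mapᵛ (punchIn j))   ≡⟨ ℤP.+-identityˡ _ ⟩
  sumTuples k (suc l) (G ∘ mapᵛ (punchIn j))        ∎
  where
  open ≡-Reasoning
  T : Fin (suc k) → ℤ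
  T i = sumTuples (suc k) l (λ w → if freshIn j (i ∷ᵛ w) then G (i ∷ᵛ w) else 0ℤ)
  T-j : T j ≡ 0ℤ
  T-j = trans (sumTuples-cong (suc k) l λ w →
                 cong (λ b → if not b ∧ freshIn j w then G (j ∷ᵛ w) else 0ℤ) (dec-true (j ≟ᶠ j) refl))
              (sumTuples-zero (suc k) l)
  T-punchIn : ∀ c → T (punchIn j c) ≡ sumTuples k l (G ∘ mapᵛ (punchIn j) ∘ (c ∷ᵛ_))
  T-punchIn c = trans (sumTuples-cong (suc k) l λ w →
                         cong (λ b → if not b ∧ freshIn j w then G (punchIn j c ∷ᵛ w) else 0ℤ)
                              (dec-false (j ≟ᶠ punchIn j c) (punchInᵢ≢i j c ∘ sym)))
                      (sumTuples-avoiding k l j (G ∘ (punchIn j c ∷ᵛ_)))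

laplace : ∀ {k} (M : Matrix (suc k)) → per M ≡ sum (λ j → M zero j * per (minor j M))
laplace {k} M = begin
  per M
    ≡⟨ per≡sumTuples M ⟩
  sum (λ j → sumTuples (suc k) k (permanentTerm M ∘ (j ∷ᵛ_)))
    ≡⟨ sum-cong-≗ {suc k} (λ j → sumTuples-cong (suc k) k (firstEntry j)) ⟩
  sum (λ j → sumTuples (suc k) k (λ w → if freshIn j w then M zero j * permanentTerm (M ∘ suc) w else 0ℤ))
    ≡⟨ sum-cong-≗ {suc k} (λ j → sumTuples-avoiding k k j (λ w → M zero j * permanentTerm (M ∘ suc) w)) ⟩
  sum (λ j → sumTuples k k (λ τ → M zero j * permanentTerm (M ∘ suc) (mapᵛ (punchIn j) τ)))
    ≡⟨ sum-cong-≗ {suc k} (λ j → sumTuples-cong k k (λ τ → cong (M zero j *_) (reindex j τ))) ⟩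
  sum (λ j → sumTuples k k (λ τ → M zero j * permanentTerm (minor j M) τ))
    ≡⟨ sum-cong-≗ {suc k} (λ j → trans (sumTuples-scale k k (M zero j) _)
                                        (cong (M zero j *_) (sym (per≡sumTuples (minor j M))))) ⟩
  sum (λ j → M zero j * per (minor j M)) ∎
  where
  open ≡-Reasoning
  firstEntry : ∀ j w →
    permanentTerm M (j ∷ᵛ w) ≡ (if freshIn j w then M zero j * permanentTerm (M ∘ suc) w else 0ℤ)
  firstEntry j w with freshIn j w | distinct w
  ... | false | _     = refl
  ... | true  | true  = refl
  ... | true  | false = sym (ℤP.*-zeroʳ (M zero j))
  reindex : ∀ j τ → permanentTerm (M ∘ suc) (mapᵛ (punchIn j) τ) ≡ permanentTerm (minor j M) τ
  reindex j τ = cong₂ (if_then_else 0ℤ) (distinct-map (punchIn-injective j _ _) τ)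
                      (cong prodℤ (tabulate-cong (λ i → cong (M (suc i)) (lookup-map i (punchIn j) τ))))

per-permuteColumns : ∀ {k} (M : Matrix k) (π : Permutation′ k) → per (λ i c → M i (π ⟨$⟩ʳ c)) ≡ per M
per-permuteColumns {zero}  M π = refl
per-permuteColumns {suc k} M π = begin
  per Mπ                                            ≡⟨ laplace Mπ ⟩
  sum (λ j → M zero (π ⟨$⟩ʳ j) * per (minor j Mπ))
    ≡⟨ sum-cong-≗ {suc k} (λ j → cong (M zero (π ⟨$⟩ʳ j) *_) (minor-permuted j)) ⟩
  sum (λ j → expansionTerm (π ⟨$⟩ʳ j))              ≡⟨ ∑-permute expansionTerm π ⟨
  sum expansionTerm                                 ≡⟨ laplace M ⟨
  per M                                             ∎
  where
  open ≡-Reasoning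
  Mπ : Matrix (suc k)
  Mπ i c = M i (π ⟨$⟩ʳ c)
  expansionTerm : Fin (suc k) → ℤ
  expansionTerm j = M zero j * per (minor j M)
  minor-permuted : ∀ j → per (minor j Mπ) ≡ per (minor (π ⟨$⟩ʳ j) M)
  minor-permuted j = trans (per-cong λ i c → cong (M (suc i)) (punchIn-permute π j c))
                           (per-permuteColumns (minor (π ⟨$⟩ʳ j) M) (remove j π))

per-columnList-↭ : ∀ {k} {C : Set} (col : C → Fin k → ℤ) {xs : List C} (f : Fin k → C) → xs ↭ tabulate f →
  (xs-len : length xs ≡ k) → per (λ i c → col (lookup xs (Fin.cast (sym xs-len) c)) i) ≡ per (λ i c → col (f c) i)
per-columnList-↭ col {xs} f xs↭f xs-len = begin
  per (λ i c → col (lookup xs (Fin.cast (sym xs-len) c)) i)  ≡⟨ per-cong (λ i c → cong (λ z → col z i) (lookup-ρ c)) ⟩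
  per (λ i c → col (f (ρ ⟨$⟩ʳ c)) i)                         ≡⟨ per-permuteColumns (λ i c → col (f c) i) ρ ⟩
  per (λ i c → col (f c) i)                                  ∎
  where
  open ≡-Reasoning
  ρ : Permutation′ _
  ρ = cast-id (sym xs-len) ∘ₚ onIndices (↭⇒↭ₛ xs↭f) ∘ₚ cast-id (length-tabulate f)
  lookup-tabulate′ : ∀ y → lookup (tabulate f) y ≡ f (Fin.cast (length-tabulate f) y)
  lookup-tabulate′ y =
    trans (cong (lookup (tabulate f)) (sym (cast-involutive (sym (length-tabulate f)) (length-tabulate f) y)))
          (lookup-tabulate f (Fin.cast (length-tabulate f) y))
  lookup-ρ : ∀ c → lookup xs (Fin.cast (sym xs-len) c) ≡ f (ρ ⟨$⟩ʳ c)
  lookup-ρ c = trans (↭ₛ.onIndices-lookup (setoid _) (↭⇒↭ₛ xs↭f) (Fin.cast (sym xs-len) c)) (lookup-tabulate′ _)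

module _ {k} (M : Matrix k) {j j′ : Fin k} (same : ∀ i → M i j ≡ M i j′) where

  transpose-sameColumns : ∀ i c → M i (transpose j j′ ⟨$⟩ʳ c) ≡ M i c
  transpose-sameColumns i c with c ≟ᶠ j
  ... | yes refl = sym (same i)
  ... | no _ with c ≟ᶠ j′
  ...   | yes refl = same i
  ...   | no _     = refl

transpose-moves : ∀ {k} (j j′ : Fin k) → transpose j j′ ⟨$⟩ʳ j ≡ j′
transpose-moves j j′ with j ≟ᶠ j
... | yes _   = refl
... | no j≢j = contradiction refl j≢j

minor-sameColumns : ∀ {k} (M : Matrix (suc k)) {j j′} → (∀ i → M i j ≡ M i j′) →
  per (minor j M) ≡ per (minor j′ M)
minor-sameColumns M {j} {j′} same = begin
  per (minor j M)
    ≡⟨ per-cong (λ i c → sym (transpose-sameColumns M same (suc i) (punchIn j c))) ⟩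
  per (λ i c → M (suc i) (τ ⟨$⟩ʳ punchIn j c))
    ≡⟨ per-cong (λ i c → cong (M (suc i)) (punchIn-permute τ j c)) ⟩
  per (λ i c → minor (τ ⟨$⟩ʳ j) M i (remove j τ ⟨$⟩ʳ c))
    ≡⟨ per-permuteColumns (minor (τ ⟨$⟩ʳ j) M) (remove j τ) ⟩
  per (minor (τ ⟨$⟩ʳ j) M)
    ≡⟨ cong (λ c → per (minor c M)) (transpose-moves j j′) ⟩
  per (minor j′ M) ∎
  where
  open ≡-Reasoning
  τ : Permutation′ _
  τ = transpose j j′

-- Linearity in a column

setColumn : ∀ {k} → Matrix k → Fin k → (Fin k → ℤ) → Matrix k
setColumn M j x i = updateAt (M i) j (const (x i))

module _ {k} (M : Matrix (suc k)) (j : Fin (suc k)) (x : Fin (suc k) → ℤ) where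

  minor-setColumn-same : ∀ i c → minor j (setColumn M j x) i c ≡ minor j M i c
  minor-setColumn-same i c = updateAt-minimal (punchIn j c) j (M (suc i)) (punchInᵢ≢i j c)

  minor-setColumn-other : ∀ {c} (c≢j : c ≢ j) → ∀ i d →
    minor c (setColumn M j x) i d ≡ setColumn (minor c M) (punchOut c≢j) (x ∘ suc) i d
  minor-setColumn-other {c} c≢j i d with d ≟ᶠ punchOut c≢j
  ... | yes refl = trans (cong (λ e → updateAt (M (suc i)) j _ e) (punchIn-punchOut c≢j))
                         (trans (updateAt-updates j (M (suc i)))
                                (sym (updateAt-updates (punchOut c≢j) (minor c M i))))
  ... | no d≢j′  = trans (updateAt-minimal (punchIn c d) j (M (suc i)) punchIn≢j)
                         (sym (updateAt-minimal d (punchOut c≢j) (minor c M i) d≢j′))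
    where
    punchIn≢j : punchIn c d ≢ j
    punchIn≢j eq = d≢j′ (punchIn-injective c d _ (trans eq (sym (punchIn-punchOut c≢j))))

per-setColumn-linear : ∀ {k} (M : Matrix k) j a b (x y : Fin k → ℤ) →
  per (setColumn M j (λ i → a * x i + b * y i)) ≡ a * per (setColumn M j x) + b * per (setColumn M j y)
per-setColumn-linear {zero}  M () a b x y
per-setColumn-linear {suc k} M j a b x y = begin
  per (setColumn M j z)
    ≡⟨ laplace (setColumn M j z) ⟩
  sum (expansion z)
    ≡⟨ sum-cong-≗ {suc k} columnwise ⟩
  sum (λ c → a * expansion x c + b * expansion y c)
    ≡⟨ ∑-distrib-+ (λ c → a * expansion x c) (λ c → b * expansion y c) ⟩
  sum (λ c → a * expansion x c) + sum (λ c → b * expansion y c)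
    ≡⟨ cong₂ _+_ (*-distribˡ-sum a (expansion x)) (*-distribˡ-sum b (expansion y)) ⟨
  a * sum (expansion x) + b * sum (expansion y)
    ≡⟨ cong₂ (λ u v → a * u + b * v) (laplace (setColumn M j x)) (laplace (setColumn M j y)) ⟨
  a * per (setColumn M j x) + b * per (setColumn M j y) ∎
  where
  open ≡-Reasoning
  *-distribʳ-combination : ∀ a b u v w → (a * u + b * v) * w ≡ a * (u * w) + b * (v * w)
  *-distribʳ-combination = solve-∀
  *-distribˡ-combination : ∀ w a b u v → w * (a * u + b * v) ≡ a * (w * u) + b * (w * v)
  *-distribˡ-combination = solve-∀
  z : Fin (suc k) → ℤ
  z i = a * x i + b * y i
  expansion : (Fin (suc k) → ℤ) → Fin (suc k) → ℤ
  expansion w c = setColumn M j w zero c * per (minor c (setColumn M j w))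
  columnwise : ∀ c → expansion z c ≡ a * expansion x c + b * expansion y c
  columnwise c with c ≟ᶠ j
  ... | yes refl = begin
    setColumn M c z zero c * per (minor c (setColumn M c z))
      ≡⟨ cong₂ _*_ (updateAt-updates c (M zero)) (per-cong (minor-setColumn-same M c z)) ⟩
    z zero * per (minor c M)
      ≡⟨ *-distribʳ-combination a b (x zero) (y zero) (per (minor c M)) ⟩
    a * (x zero * per (minor c M)) + b * (y zero * per (minor c M))
      ≡⟨ cong₂ (λ u v → a * u + b * v)
           (cong₂ _*_ (updateAt-updates c (M zero)) (per-cong (minor-setColumn-same M c x)))
           (cong₂ _*_ (updateAt-updates c (M zero)) (per-cong (minor-setColumn-same M c y))) ⟨
    a * expansion x c + b * expansion y c ∎
  ... | no c≢j = begin
    setColumn M j z zero c * per (minor c (setColumn M j z))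
      ≡⟨ cong₂ _*_ (updateAt-minimal c j (M zero) c≢j) (per-cong (minor-setColumn-other M j z c≢j)) ⟩
    M zero c * per (setColumn M′ j′ (z ∘ suc))
      ≡⟨ cong (M zero c *_) (per-setColumn-linear M′ j′ a b (x ∘ suc) (y ∘ suc)) ⟩
    M zero c * (a * per (setColumn M′ j′ (x ∘ suc)) + b * per (setColumn M′ j′ (y ∘ suc)))
      ≡⟨ *-distribˡ-combination (M zero c) a b _ _ ⟩
    a * (M zero c * per (setColumn M′ j′ (x ∘ suc))) + b * (M zero c * per (setColumn M′ j′ (y ∘ suc)))
      ≡⟨ cong₂ (λ u v → a * u + b * v)
           (cong₂ _*_ (updateAt-minimal c j (M zero) c≢j) (per-cong (minor-setColumn-other M j x c≢j)))
           (cong₂ _*_ (updateAt-minimal c j (M zero) c≢j) (per-cong (minor-setColumn-other M j y c≢j))) ⟨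
    a * expansion x c + b * expansion y c ∎
    where
    M′ : Matrix k
    M′ = minor c M
    j′ : Fin k
    j′ = punchOut c≢j

per-setColumn-cong : ∀ {k} (M : Matrix k) j {x y : Fin k → ℤ} → (∀ i → x i ≡ y i) →
  per (setColumn M j x) ≡ per (setColumn M j y)
per-setColumn-cong M j eq = per-cong λ i → updateAt-cong-local j (M i) (eq i)

per-setColumn-self : ∀ {k} (M : Matrix k) j → per (setColumn M j (λ i → M i j)) ≡ per M
per-setColumn-self M j = per-cong λ i → updateAt-id-local j (M i) refl

per-setColumn-scale : ∀ {k} (M : Matrix k) j a (x : Fin k → ℤ) →
  per (setColumn M j (λ i → a * x i)) ≡ a * per (setColumn M j x)
per-setColumn-scale M j a x = begin
  per (setColumn M j (λ i → a * x i))                      ≡⟨ per-setColumn-cong M j (λ i → sym (+0* (a * x i) (x i))) ⟩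
  per (setColumn M j (λ i → a * x i + 0ℤ * x i))           ≡⟨ per-setColumn-linear M j a 0ℤ x x ⟩
  a * per (setColumn M j x) + 0ℤ * per (setColumn M j x)   ≡⟨ +0* (a * per (setColumn M j x)) (per (setColumn M j x)) ⟩
  a * per (setColumn M j x)                                ∎
  where
  open ≡-Reasoning
  +0* : ∀ u v → u + 0ℤ * v ≡ u
  +0* = solve-∀

Combination : Set → Set
Combination C = List (ℤ × C)

combine : ∀ {C : Set} → Combination C → (C → ℤ) → ℤ
combine []            w = 0ℤ
combine ((a , z) ∷ L) w = a * w z + combine L w

combine-++ : ∀ {C : Set} (L L′ : Combination C) w → combine (L ++ L′) w ≡ combine L w + combine L′ w
combine-++ []            L′ w = sym (ℤP.+-identityˡ _)
combine-++ ((a , z) ∷ L) L′ w =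
  trans (cong (_+_ (a * w z)) (combine-++ L L′ w)) (sym (ℤP.+-assoc (a * w z) _ _))

combine-scale : ∀ {C : Set} a (L : Combination C) w → combine (map (map₁ (a *_)) L) w ≡ a * combine L w
combine-scale a []            w = sym (ℤP.*-zeroʳ a)
combine-scale a ((b , z) ∷ L) w =
  trans (cong (_+_ (a * b * w z)) (combine-scale a L w)) (distrib a b (w z) (combine L w))
  where distrib : ∀ a b c d → a * b * c + a * d ≡ a * (b * c + d)
        distrib = solve-∀

per-setColumn-combination : ∀ {k} {C : Set} (M : Matrix k) j (L : Combination C) (x : C → Fin k → ℤ) →
  per (setColumn M j (λ i → combine L (λ z → x z i))) ≡ combine L (λ z → per (setColumn M j (x z)))
per-setColumn-combination M j [] x = per-setColumn-linear M j 0ℤ 0ℤ (λ _ → 0ℤ) (λ _ → 0ℤ)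
per-setColumn-combination M j ((a , z) ∷ L) x = begin
  per (setColumn M j (λ i → a * x z i + rest i))
    ≡⟨ per-setColumn-cong M j (λ i → cong (_+_ (a * x z i)) (sym (ℤP.*-identityˡ (rest i)))) ⟩
  per (setColumn M j (λ i → a * x z i + 1ℤ * rest i))
    ≡⟨ per-setColumn-linear M j a 1ℤ (x z) rest ⟩
  a * per (setColumn M j (x z)) + 1ℤ * per (setColumn M j rest)
    ≡⟨ cong (_+_ (a * per (setColumn M j (x z)))) (ℤP.*-identityˡ _) ⟩
  a * per (setColumn M j (x z)) + per (setColumn M j rest)
    ≡⟨ cong (_+_ (a * per (setColumn M j (x z)))) (per-setColumn-combination M j L x) ⟩
  combine ((a , z) ∷ L) (λ z → per (setColumn M j (x z))) ∎
  where
  open ≡-Reasoning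
  rest : _ → ℤ
  rest i = combine L (λ z → x z i)

per-scaledColumn-combination : ∀ {k} {C : Set} (M : Matrix k) j a (L : Combination C) (x : C → Fin k → ℤ) →
  (∀ i → combine L (λ z → x z i) ≡ a * M i j) → a * per M ≡ combine L (λ z → per (setColumn M j (x z)))
per-scaledColumn-combination M j a L x L≡aMj = begin
  a * per M                                            ≡⟨ cong (a *_) (per-setColumn-self M j) ⟨
  a * per (setColumn M j (λ i → M i j))                ≡⟨ per-setColumn-scale M j a (λ i → M i j) ⟨
  per (setColumn M j (λ i → a * M i j))                ≡⟨ per-setColumn-cong M j (λ i → sym (L≡aMj i)) ⟩
  per (setColumn M j (λ i → combine L (λ z → x z i)))  ≡⟨ per-setColumn-combination M j L x ⟩
  combine L (λ z → per (setColumn M j (x z)))          ∎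
  where open ≡-Reasoning

-- Repeated columns

indicator : Bool → ℕ
indicator b = if b then 1 else 0

count : ∀ {k} → (Fin k → Bool) → ℕ
count b = ∑ℕ (indicator ∘ b)

count-remove : ∀ {k} (b : Fin (suc k) → Bool) j → count b ≡ indicator (b j) ℕ.+ count (b ∘ punchIn j)
count-remove b j = ∑ℕ-remove {i = j} (indicator ∘ b)

count-remove-false : ∀ {k} (b : Fin (suc k) → Bool) {j} → b j ≡ false → count b ≡ count (b ∘ punchIn j)
count-remove-false b {j} bj = trans (count-remove b j) (cong (λ β → indicator β ℕ.+ count (b ∘ punchIn j)) bj)

count-remove-true : ∀ {k} (b : Fin (suc k) → Bool) {j} → b j ≡ true → count b ≡ suc (count (b ∘ punchIn j))
count-remove-true b {j} bj = trans (count-remove b j) (cong (λ β → indicator β ℕ.+ count (b ∘ punchIn j)) bj)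

sum-collect : ∀ {k} (b : Fin k → Bool) (F : Fin k → ℤ) Y → (∀ j → b j ≡ true → F j ≡ Y) →
  sum F ≡ + count b * Y + sum (λ j → if b j then 0ℤ else F j)
sum-collect {zero}  b F Y _ = sym (ℤP.*-zeroˡ Y)
sum-collect {suc k} b F Y marked with b zero in b₀
... | true  = trans (cong₂ _+_ (marked zero b₀) (sum-collect (b ∘ suc) (F ∘ suc) Y (marked ∘ suc)))
                    (trans (rearrange Y (+ count (b ∘ suc)) rest)
                           (cong (λ c → c * Y + (0ℤ + rest)) (sym (ℤP.pos-+ 1 (count (b ∘ suc))))))
  where
  rest : ℤ
  rest = sum (λ j → if b (suc j) then 0ℤ else F (suc j))
  rearrange : ∀ Y c s → Y + (c * Y + s) ≡ (+ 1 + c) * Y + (0ℤ + s)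
  rearrange = solve-∀
... | false = trans (cong (_+_ (F zero)) (sum-collect (b ∘ suc) (F ∘ suc) Y (marked ∘ suc)))
                    (rearrange (F zero) (+ count (b ∘ suc) * Y) _)
  where
  rearrange : ∀ f c s → f + (c + s) ≡ c + (f + s)
  rearrange = solve-∀

∣ₛ0 : ∀ d → d ∣ₛ 0ℤ
∣ₛ0 d = divides 0ℤ (sym (ℤP.*-zeroˡ d))

∣ₛ-sum : ∀ {k} d (F : Fin k → ℤ) → (∀ j → d ∣ₛ F j) → d ∣ₛ sum F
∣ₛ-sum {zero}  d F _   = ∣ₛ0 d
∣ₛ-sum {suc k} d F d∣F = ∣m∣n⇒∣m+n (d∣F zero) (∣ₛ-sum d (F ∘ suc) (d∣F ∘ suc))

-- Expanding along the first row, the minors of unmarked columns keep all the marked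
-- columns, while those of the marked columns all have the same permanent (minor-sameColumns)
-- and one marked column fewer: together they contribute count b times a multiple of (count b - 1)!.
factorial-∣-per : ∀ {k} (M : Matrix k) (b : Fin k → Bool) (x : Fin k → ℤ) →
  (∀ j → b j ≡ true → ∀ i → M i j ≡ x i) → + (count b !) ∣ₛ per M
factorial-∣-per {zero}  M b x marked = divides (per M) (sym (ℤP.*-identityʳ (per M)))
factorial-∣-per {suc k} M b x marked =
  subst (+ (count b !) ∣ₛ_) (sym (laplace M)) (∣-expansion (any? λ j → b j ≟ᵇ true))
  where
  expansion : Fin (suc k) → ℤ
  expansion j = M zero j * per (minor j M)
  minor-∣ : ∀ j → + (count (b ∘ punchIn j) !) ∣ₛ per (minor j M)
  minor-∣ j = factorial-∣-per (minor j M) (b ∘ punchIn j) (x ∘ suc) (λ c bc i → marked (punchIn j c) bc (suc i))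
  unmarked-∣ : ∀ j → b j ≡ false → + (count b !) ∣ₛ expansion j
  unmarked-∣ j bj =
    ∣n⇒∣m*n (M zero j) (subst (λ t → + (t !) ∣ₛ per (minor j M)) (sym (count-remove-false b bj)) (minor-∣ j))
  masked-∣ : ∀ j → + (count b !) ∣ₛ (if b j then 0ℤ else expansion j)
  masked-∣ j with b j in bj
  ... | true  = ∣ₛ0 _
  ... | false = unmarked-∣ j bj
  ∣-expansion : Dec (∃ λ j → b j ≡ true) → + (count b !) ∣ₛ sum expansion
  ∣-expansion (no none) = ∣ₛ-sum _ expansion λ j → unmarked-∣ j (¬-not (λ bj → none (j , bj)))
  ∣-expansion (yes (j₀ , bj₀)) =
    subst (+ (count b !) ∣ₛ_) (sym (sum-collect b expansion Y sameTerm))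
          (∣m∣n⇒∣m+n collected-∣ (∣ₛ-sum _ _ masked-∣))
    where
    Y : ℤ
    Y = x zero * per (minor j₀ M)
    sameTerm : ∀ j → b j ≡ true → expansion j ≡ Y
    sameTerm j bj =
      cong₂ _*_ (marked j bj zero) (minor-sameColumns M λ i → trans (marked j bj i) (sym (marked j₀ bj₀ i)))
    collected-∣ : + (count b !) ∣ₛ + count b * Y
    collected-∣ rewrite count-remove-true b bj₀ =
      subst (_∣ₛ + suc t * Y) (sym (ℤP.pos-* (suc t) (t !))) (*-monoʳ-∣ (+ suc t) (∣n⇒∣m*n (x zero) (minor-∣ j₀)))
      where
      t : ℕ
      t = count (b ∘ punchIn j₀)

m≤n⇒m∣n! : ∀ {m n} .{{_ : ℕ.NonZero m}} → m ℕ.≤ n → m ℕ∣ n !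
m≤n⇒m∣n! {suc q} m≤n = ℕ∣-trans (m∣m*n (q !)) (m≤n⇒m!∣n! m≤n)

≰⇒≤∸1 : ∀ {m n} → ¬ (m ℕ.≤ n) → n ℕ.≤ m ∸ 1
≰⇒≤∸1 {zero}  m≰n = contradiction ℕ.z≤n m≰n
≰⇒≤∸1 {suc _} m≰n = ℕ.s≤s⁻¹ (ℕP.≰⇒> m≰n)

count-sameColumns-≤ : ∀ {k p} .{{_ : ℕ.NonZero p}} (M : Matrix k) (b : Fin k → Bool) (x : Fin k → ℤ) →
  (∀ j → b j ≡ true → ∀ i → M i j ≡ x i) → ¬ (+ p ∣ₛ per M) → count b ℕ.≤ p ∸ 1
count-sameColumns-≤ {p = p} M b x marked p∤ with p ℕ.≤? count b
... | no  p≰count = ≰⇒≤∸1 p≰count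
... | yes p≤count = contradiction (∣-trans (∣ᵤ⇒∣ (m≤n⇒m∣n! p≤count)) (factorial-∣-per M b x marked)) p∤

odd-prime-∤-2* : ∀ {p x} → Prime p → p ≢ 2 → ¬ (+ p ∣ₛ x) → ¬ (+ p ∣ₛ + 2 * x)
odd-prime-∤-2* {p} {x} p-prime p≢2 p∤x p∣2x
  with euclidsLemma 2 ℤ.∣ x ∣ p-prime (subst (p ℕ∣_) (ℤP.abs-* (+ 2) x) (∣⇒∣ᵤ p∣2x))
... | inj₁ p∣2 = p≢2 (ℕP.≤-antisym (ℕ∣⇒≤ p∣2) (nonTrivial⇒n>1 p {{prime⇒nonTrivial p-prime}}))
... | inj₂ p∣x = p∤x (∣ᵤ⇒∣ p∣x)

∤-combine : ∀ {C : Set} d (L : Combination C) (w : C → ℤ) → ¬ (d ∣ₛ combine L w) → ∃ λ z → ¬ (d ∣ₛ w z)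
∤-combine d []            w d∤0 = contradiction (∣ₛ0 d) d∤0
∤-combine d ((a , z) ∷ L) w d∤L with d ∣? w z
... | no  d∤z = z , d∤z
... | yes d∣z = ∤-combine d L w λ d∣rest → d∤L (∣m∣n⇒∣m+n (∣n⇒∣m*n a d∣z) d∣rest)

module _ {A : Set} (_≟_ : DecidableEquality A) where

  multiplicity : ∀ {k} → (Fin k → A) → A → ℕ
  multiplicity f z = count (λ c → does (f c ≟ z))

  multiplicity-marks : ∀ {k} (f : Fin k → A) c {z} → does (f c ≟ z) ≡ true → f c ≡ z
  multiplicity-marks f c {z} marked with f c ≟ z
  ... | yes fc≡z = fc≡z
  ... | no  _    = contradiction marked λ ()

  replicateAll : (A → ℕ) → List A → List A
  replicateAll r = concatMap (λ z → replicate (r z) z)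

  addOne : A → (A → ℕ) → A → ℕ
  addOne x r z = indicator (does (x ≟ z)) ℕ.+ r z

  replicateAll-absent : ∀ x (r : A → ℕ) {U} → All (x ≢_) U → replicateAll (addOne x r) U ≡ replicateAll r U
  replicateAll-absent x r []                = refl
  replicateAll-absent x r (_∷_ {u} x≢u x∉U) =
    cong₂ (λ a rest → replicate a u ++ rest)
          (cong (λ b → indicator b ℕ.+ r u) (dec-false (x ≟ u) x≢u)) (replicateAll-absent x r x∉U)

  replicateAll-addOne : ∀ x (r : A → ℕ) {U} → Unique U → x ∈ U → replicateAll (addOne x r) U ↭ x ∷ replicateAll r U
  replicateAll-addOne x r (x∉U ∷ _) (here refl) = ↭-reflexive
    (cong₂ (λ a rest → replicate a x ++ rest)
           (cong (λ b → indicator b ℕ.+ r x) (dec-true (x ≟ x) refl)) (replicateAll-absent x r x∉U))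
  replicateAll-addOne x r {u ∷ U} (u∉U ∷ U!) (there x∈U) = begin
    replicate (addOne x r u) u ++ replicateAll (addOne x r) U
      ≡⟨ cong (λ b → replicate (indicator b ℕ.+ r u) u ++ replicateAll (addOne x r) U)
              (dec-false (x ≟ u) (≢-sym (All.lookup u∉U x∈U))) ⟩
    replicate (r u) u ++ replicateAll (addOne x r) U  ↭⟨ ++⁺ˡ (replicate (r u) u) (replicateAll-addOne x r U! x∈U) ⟩
    replicate (r u) u ++ x ∷ replicateAll r U          ↭⟨ shift x (replicate (r u) u) _ ⟩
    x ∷ replicateAll r (u ∷ U)                         ∎
    where open PermutationReasoning

  replicateAll-multiplicity : ∀ {U} → Unique U → (∀ x → x ∈ U) →
    ∀ {k} (f : Fin k → A) → replicateAll (multiplicity f) U ↭ tabulate f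
  replicateAll-multiplicity {U} U! complete {zero}  f = ↭-reflexive (replicateAll-zero U)
    where
    replicateAll-zero : ∀ U → replicateAll (λ _ → 0) U ≡ []
    replicateAll-zero []      = refl
    replicateAll-zero (_ ∷ U) = replicateAll-zero U
  replicateAll-multiplicity U! complete {suc k} f =
    ↭-trans (replicateAll-addOne (f zero) _ U! (complete (f zero)))
            (prep (f zero) (replicateAll-multiplicity U! complete (f ∘ suc)))

-- Vertex and edge columns of A_G

module _ (G : Graph) where
  open Graph G

  vertexColumn : Fin n → Fin m → ℤ
  vertexColumn v e = A G e (inj₁ v)

  edgeColumn : Fin m → Fin m → ℤ
  edgeColumn f e = A G e (inj₂ f)

  edgeColumn≡tl+hd : ∀ f e → edgeColumn f e ≡ vertexColumn (tl f) e + vertexColumn (hd f) e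
  edgeColumn≡tl+hd f e with f ≟ᶠ e | tl f ≟ᶠ hd e | tl f ≟ᶠ tl e | hd f ≟ᶠ hd e | hd f ≟ᶠ tl e
  ... | yes refl | no _  | yes _ | yes _ | _     = refl
  ... | yes refl | yes x | _     | _     | _     = contradiction x (loopless f)
  ... | yes refl | no _  | no x  | _     | _     = contradiction refl x
  ... | yes refl | no _  | yes _ | no x  | _     = contradiction refl x
  ... | no _     | yes x | _     | yes y | _     = contradiction (trans x (sym y)) (loopless f)
  ... | no _     | yes x | yes y | _     | _     = contradiction (trans (sym y) x) (loopless e)
  ... | no f≢e   | yes x | _     | _     | yes y = contradiction (simple f e (inj₂ (x , y))) f≢e
  ... | no _     | yes _ | no _  | no _  | no _  = refl
  ... | no _     | no _  | yes x | _     | yes y = contradiction (trans x (sym y)) (loopless f)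
  ... | no f≢e   | no _  | yes x | yes y | _     = contradiction (simple f e (inj₁ (x , y))) f≢e
  ... | no _     | no _  | yes _ | no _  | no _  = refl
  ... | no _     | no _  | no _  | yes x | yes y = contradiction (trans (sym y) x) (loopless e)
  ... | no _     | no _  | no _  | yes _ | no _  = refl
  ... | no _     | no _  | no _  | no _  | yes _ = refl
  ... | no _     | no _  | no _  | no _  | no _  = refl

  InEdgeSpan : (Fin m → ℤ) → Set
  InEdgeSpan x = Σ (Combination (Fin m)) λ L → ∀ e → combine L (λ f → edgeColumn f e) ≡ x e

  span-cong : ∀ {x y} → (∀ e → x e ≡ y e) → InEdgeSpan x → InEdgeSpan y
  span-cong x≗y (L , L≗x) = L , λ e → trans (L≗x e) (x≗y e)

  span-+ : ∀ {x y} → InEdgeSpan x → InEdgeSpan y → InEdgeSpan (λ e → x e + y e)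
  span-+ (L , L≗x) (L′ , L′≗y) = L ++ L′ , λ e → trans (combine-++ L L′ _) (cong₂ _+_ (L≗x e) (L′≗y e))

  span-scale : ∀ a {x} → InEdgeSpan x → InEdgeSpan (λ e → a * x e)
  span-scale a (L , L≗x) = map (map₁ (a *_)) L , λ e → trans (combine-scale a L _) (cong (a *_) (L≗x e))

  span-edge : ∀ f → InEdgeSpan (λ e → vertexColumn (tl f) e + vertexColumn (hd f) e)
  span-edge f = (1ℤ , f) ∷ [] , λ e → trans (trans (ℤP.+-identityʳ _) (ℤP.*-identityˡ _)) (edgeColumn≡tl+hd f e)

  span-adjacent : ∀ {u v} → Adj G u v → InEdgeSpan (λ e → vertexColumn u e + vertexColumn v e)
  span-adjacent (f , inj₁ (refl , refl)) = span-edge f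
  span-adjacent (f , inj₂ (refl , refl)) = span-cong (λ e → ℤP.+-comm (vertexColumn (tl f) e) _) (span-edge f)

  parity : ∀ {u v} → Star (Adj G) u v → Bool
  parity ε       = false
  parity (_ ◅ w) = not (parity w)

  sign : Bool → ℤ
  sign false = 1ℤ
  sign true  = -1ℤ

  span-walk : ∀ {u v} (w : Star (Adj G) u v) →
    InEdgeSpan (λ e → vertexColumn u e - sign (parity w) * vertexColumn v e)
  span-walk {u} ε = [] , λ e → 0≡x-1*x (vertexColumn u e)
    where
    0≡x-1*x : ∀ x → 0ℤ ≡ x - 1ℤ * x
    0≡x-1*x = solve-∀
  span-walk {u} {v} (_◅_ {j = x} u~x w) =
    span-cong telescope (span-+ (span-adjacent u~x) (span-scale -1ℤ (span-walk w)))
    where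
    telescope : ∀ e → vertexColumn u e + vertexColumn x e + -1ℤ * (vertexColumn x e - sign (parity w) * vertexColumn v e)
                    ≡ vertexColumn u e - sign (not (parity w)) * vertexColumn v e
    telescope e with parity w
    ... | false = even (vertexColumn u e) (vertexColumn x e) (vertexColumn v e)
      where
      even : ∀ a b c → a + b + -1ℤ * (b - 1ℤ * c) ≡ a - -1ℤ * c
      even = solve-∀
    ... | true  = odd (vertexColumn u e) (vertexColumn x e) (vertexColumn v e)
      where
      odd : ∀ a b c → a + b + -1ℤ * (b - -1ℤ * c) ≡ a - 1ℤ * c
      odd = solve-∀

  -- Colour each vertex by the parity of a walk to it from v.  As G is not bipartite, some
  -- edge e₀ is monochromatic, and the walks to its two ends close up through e₀ into a walk
  -- of odd length from v to v.
  span-twiceVertexColumn : Connected G → ¬ Bipartite G → ∀ v → InEdgeSpan (λ e → + 2 * vertexColumn v e)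
  span-twiceVertexColumn connected nonBipartite v =
    span-cong collapse (span-+ (span-+ (span-walk (connected v (tl e₀))) (span-walk (connected v (hd e₀))))
                               (span-scale s (span-edge e₀)))
    where
    colour : Fin n → Bool
    colour x = parity (connected v x)
    monochromatic : ∃ λ e → colour (tl e) ≡ colour (hd e)
    monochromatic with ¬∀⟶∃¬ m _ (λ e → ¬? (colour (tl e) ≟ᵇ colour (hd e))) (λ proper → nonBipartite (colour , proper))
    ... | e , improper = e , decidable-stable (colour (tl e) ≟ᵇ colour (hd e)) improper
    e₀ : Fin m
    e₀ = proj₁ monochromatic
    s : ℤ
    s = sign (colour (tl e₀))
    collapse : ∀ e → vertexColumn v e - s * vertexColumn (tl e₀) e
                       + (vertexColumn v e - sign (colour (hd e₀)) * vertexColumn (hd e₀) e)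
                       + s * (vertexColumn (tl e₀) e + vertexColumn (hd e₀) e)
                     ≡ + 2 * vertexColumn v e
    collapse e rewrite sym (proj₂ monochromatic) =
      cancel (vertexColumn v e) (vertexColumn (tl e₀) e) (vertexColumn (hd e₀) e) s
      where
      cancel : ∀ x t h s → x - s * t + (x - s * h) + s * (t + h) ≡ + 2 * x
      cancel = solve-∀

  -- Eliminating vertex columns

  Labelling : Set
  Labelling = Fin m → Idx G

  labelled : Labelling → Matrix m
  labelled g e c = A G e (g c)

  relabel : Labelling → Fin m → Idx G → Labelling
  relabel g j z = updateAt g j (const z)

  per-relabel : ∀ g j z → per (labelled (relabel g j z)) ≡ per (setColumn (labelled g) j (λ e → A G e z))
  per-relabel g j z = per-cong λ e → map-updateAt-local {f = A G e} g j refl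

  IsEdge : Idx G → Set
  IsEdge z = ∃ λ f → z ≡ inj₂ f

  _⊑_ : Labelling → Labelling → Set
  g ⊑ g′ = ∀ c → IsEdge (g c) → IsEdge (g′ c)

  ⊑-relabel : ∀ g j f → g ⊑ relabel g j (inj₂ f)
  ⊑-relabel g j f c isEdge with c ≟ᶠ j
  ... | yes refl = f , updateAt-updates j g
  ... | no c≢j   = subst IsEdge (sym (updateAt-minimal c j g c≢j)) isEdge

  -- Results are destructured with let: with-abstracting over them makes Agda normalise
  -- the permanents in the goal.
  module _ (connected : Connected G) (nonBipartite : ¬ Bipartite G) {p} (p-prime : Prime p) (p≢2 : p ≢ 2) where

    replaceVertexColumn : ∀ g j {v} → g j ≡ inj₁ v → ¬ (+ p ∣ₛ per (labelled g)) →
      ∃ λ f → ¬ (+ p ∣ₛ per (labelled (relabel g j (inj₂ f))))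
    replaceVertexColumn g j {v} g-j p∤ =
      let L , L≡2v = span-twiceVertexColumn connected nonBipartite v
          expand = per-scaledColumn-combination (labelled g) j (+ 2) L edgeColumn
                     (λ e → trans (L≡2v e) (cong (λ z → + 2 * A G e z) (sym g-j)))
          f , p∤f = ∤-combine (+ p) L _ (subst (¬_ ∘ (+ p ∣ₛ_)) expand (odd-prime-∤-2* p-prime p≢2 p∤))
      in  f , subst (¬_ ∘ (+ p ∣ₛ_)) (sym (per-relabel g j (inj₂ f))) p∤f

    EdgeRefinement : Labelling → (Labelling → Set) → Set
    EdgeRefinement g Done = Σ Labelling λ g′ → ¬ (+ p ∣ₛ per (labelled g′)) × g ⊑ g′ × Done g′

    makeColumnEdge : ∀ g j → ¬ (+ p ∣ₛ per (labelled g)) → EdgeRefinement g (λ g′ → IsEdge (g′ j))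
    makeColumnEdge g j p∤ = byLabel (g j) refl
      where
      byLabel : ∀ z → g j ≡ z → EdgeRefinement g (λ g′ → IsEdge (g′ j))
      byLabel (inj₂ f) g-j = g , p∤ , (λ _ isEdge → isEdge) , f , g-j
      byLabel (inj₁ v) g-j =
        let f , p∤′ = replaceVertexColumn g j g-j p∤
        in  relabel g j (inj₂ f) , p∤′ , ⊑-relabel g j f , f , updateAt-updates j g

    makeColumnsEdges : ∀ js g → ¬ (+ p ∣ₛ per (labelled g)) →
      EdgeRefinement g (λ g′ → ∀ c → c ∈ js → IsEdge (g′ c))
    makeColumnsEdges []       g p∤ = g , p∤ , (λ _ isEdge → isEdge) , λ _ ()
    makeColumnsEdges (j ∷ js) g p∤ =
      let g₁ , p∤₁ , g⊑g₁ , edge-j     = makeColumnEdge g j p∤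
          g₂ , p∤₂ , g₁⊑g₂ , edges-js = makeColumnsEdges js g₁ p∤₁
      in  g₂ , p∤₂ , (λ c → g₁⊑g₂ c ∘ g⊑g₁ c)
        , λ { c (here refl) → g₁⊑g₂ j edge-j ; c (there c∈js) → edges-js c c∈js }

    edgeLabelling : ∀ g → ¬ (+ p ∣ₛ per (labelled g)) →
      Σ (Fin m → Fin m) λ h → ¬ (+ p ∣ₛ per (labelled (inj₂ ∘ h)))
    edgeLabelling g p∤ =
      let g′ , p∤′ , _ , edges = makeColumnsEdges (allFin m) g p∤
          edge = λ c → edges c (∈-allFin c)
      in  proj₁ ∘ edge , subst (¬_ ∘ (+ p ∣ₛ_)) (per-cong λ e c → cong (A G e) (proj₂ (edge c))) p∤′

  _≟ᴵ_ : DecidableEquality (Idx G)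
  _≟ᴵ_ = ≡-dec _≟ᶠ_ _≟ᶠ_

  allIdx-unique : Unique (allIdx G)
  allIdx-unique =
    Unique.++⁺ (Unique.map⁺ inj₁-injective (Unique.allFin⁺ n)) (Unique.map⁺ inj₂-injective (Unique.allFin⁺ m)) disjoint
    where
    disjoint : ∀ {z} → ¬ (z ∈ map inj₁ (allFin n) × z ∈ map inj₂ (allFin m))
    disjoint (z∈₁ , z∈₂) with ∈-map⁻ inj₁ z∈₁ | ∈-map⁻ inj₂ z∈₂
    ... | _ , _ , refl | _ , _ , ()

  allIdx-complete : ∀ z → z ∈ allIdx G
  allIdx-complete (inj₁ v) = ∈-++⁺ˡ (∈-map⁺ inj₁ (∈-allFin v))
  allIdx-complete (inj₂ f) = ∈-++⁺ʳ (map inj₁ (allFin n)) (∈-map⁺ inj₂ (∈-allFin f))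

  indexFunction : Labelling → IndexFunction G
  indexFunction = multiplicity _≟ᴵ_

  columns-indexFunction : ∀ g → columns G (indexFunction g) ↭ tabulate g
  columns-indexFunction = replicateAll-multiplicity _≟ᴵ_ allIdx-unique allIdx-complete

  square-indexFunction : ∀ g → Square G (indexFunction g)
  square-indexFunction g = trans (↭-length (columns-indexFunction g)) (length-tabulate g)

  per-indexFunction : ∀ g → per (AG G (indexFunction g) (square-indexFunction g)) ≡ per (labelled g)
  per-indexFunction g = per-columnList-↭ (λ z e → A G e z) g (columns-indexFunction g) (square-indexFunction g)

  indexFunction-≤ : ∀ {p} .{{_ : ℕ.NonZero p}} g → ¬ (+ p ∣ₛ per (labelled g)) →
    ∀ z → indexFunction g z ℕ.≤ p ∸ 1
  indexFunction-≤ g p∤ z = count-sameColumns-≤ (labelled g) (λ c → does (g c ≟ᴵ z)) (λ e → A G e z)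
    (λ c marked e → cong (A G e) (multiplicity-marks _≟ᴵ_ g c marked)) p∤

  indexFunction-edges : ∀ (h : Fin m → Fin m) v → indexFunction (inj₂ ∘ h) (inj₁ v) ℕ.≤ 0
  indexFunction-edges h v = ℕP.≤-reflexive (∑ℕ-replicate-zero m)

lemma1 : (G : Graph) → Connected G → ¬ Bipartite G →
    (p : ℕ) → Prime p → p ≢ 2 →
    (η : IndexFunction G) → (∀ e → η (inj₂ e) ≡ 0) → (sq : Square G η) →
    ¬ ((+ p) ∣ per (AG G η sq)) →
    HasPNS-ab-Matrix G 0 (p ∸ 1)
lemma1 G connected nonBipartite p p-prime p≢2 η _ sq p∤per =
  let h , p∤h = edgeLabelling G connected nonBipartite p-prime p≢2
                  (λ c → lookup (columns G η) (Fin.cast (sym sq) c)) (p∤per ∘ ∣⇒∣ᵤ)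
      instance p≢0 : ℕ.NonZero p
               p≢0 = ℕ.nonTrivial⇒nonZero p {{prime⇒nonTrivial p-prime}}
  in  indexFunction G (inj₂ ∘ h)
    , indexFunction-edges G h
    , indexFunction-≤ G (inj₂ ∘ h) p∤h ∘ inj₂
    , square-indexFunction G (inj₂ ∘ h)
    , λ per≡0 → p∤h (subst (+ p ∣ₛ_) (trans (sym per≡0) (per-indexFunction G (inj₂ ∘ h))) (∣ₛ0 (+ p)))
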